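{- Let $X$ be a nonempty set, let $\mathcal{F}$ be a family of subsets of $X$ which is closed under intersections and contains $X$, and let $L$ be a complete lattice. Suppose $L_0\subseteq L$ is such that $(\mathcal{F},\supseteq)\cong(L_0,\leq)$ and $L_0$ can be embedded into $L$ by $\iota_{(L_0,L)}$-embedding. Let $g\in H_{(L_0,L_0,\mathcal{F})}$. Then $$H_{(L_0,L_0,\mathcal{F})}=\{\eta\circ g\mid \eta\in OI(L_0)\}\quad\text{and}\quad H_{(L,L_0,\mathcal{F})}=\{\iota_{(L_0,L)}\circ\eta\circ g\mid\eta\in OI(L_0)\}.$$
   Context: For a complete lattice $K$ and $\mu:X\to K$, $\mu_p=\{x\in X\mid\mu(x)\geq p\}$ for $p\in K$, $\mu_K=\{\mu_p\mid p\in K\}$, and $K^{\mu}=\{p\in K\mid p=\bigwedge B\text{ for some }B\subseteq\mu(X)\}$ (infima in $K$; $\bigwedge\emptyset$ is the top of $K$). For a sub-poset $M$ of $N$, $\iota_{(M,N)}:M\to N$ is the inclusion $x\mapsto x$. "$L_0$ can be embedded into $L$ by $\iota_{(L_0,L)}$-embedding" means: for every $S\subseteq L_0$ the infimum of $S$ in $L_0$ exists and equals its infimum in $L$, and the top of $L_0$ is $1_L$. Define $H_{(L_0,L_0,\mathcal{F})}=\{\mu\mid\mu:X\to L_0,\ L_0^{\mu}=L_0,\ \mu_{L_0}=\mathcal{F}\}$ and $H_{(L,L_0,\mathcal{F})}=\{\mu\mid\mu:X\to L,\ L^{\mu}=L_0,\ \mu_L=\mathcal{F}\}$. $OI(L_0)$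 denotes the set of lattice isomorphisms of $L_0$ onto itself. -}

module Defs where

open import Level using (Level; _⊔_; suc; Lift)
open import Data.Unit.Polymorphic using (⊤)
open import Data.Empty.Polymorphic using (⊥)
open import Data.Product using (Σ; Σ-syntax; ∃; _×_; _,_)
open import Data.Sum using (_⊎_)
open import Relation.Binary.PropositionalEquality using (_≡_)
open import Relation.Binary.Structures using (IsPartialOrder)

_⇔_ : ∀ {a b} → Set a → Set b → Set (a ⊔ b)
A ⇔ B = (A → B) × (B → A)

Subset : ∀ {ℓ} → Set ℓ → Set (suc ℓ)
Subset {ℓ} X = X → Set ℓ

_⊆_ : ∀ {ℓ} {X : Set ℓ} → Subset X → Subset X → Set ℓ
A ⊆ B = ∀ x → A x → B x

_≐_ : ∀ {ℓ} {X : Set ℓ} → Subset X → Subset X → Set ℓ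
A ≐ B = A ⊆ B × B ⊆ A

⋂ : ∀ {ℓ} {X : Set ℓ} {I : Set ℓ} → (I → Subset X) → Subset X
⋂ A x = ∀ i → A i x

Whole : ∀ {ℓ} (X : Set ℓ) → Subset X
Whole X _ = ⊤

ClosedUnderIntersections : ∀ {ℓ f} {X : Set ℓ} → (Subset X → Set f) → Set (suc ℓ ⊔ f)
ClosedUnderIntersections {ℓ} {X = X} F =
  (I : Set ℓ) (A : I → Subset X) → (∀ i → F (A i)) → F (⋂ A)

record CompleteLattice (ℓ : Level) : Set (suc ℓ) where
  field
    Carrier        : Set ℓ
    _≤_            : Carrier → Carrier → Set ℓ
    isPartialOrder : IsPartialOrder _≡_ _≤_
    ⋀              : (Carrier → Set ℓ) → Carrier
    ⋀-lower        : ∀ S x → S x → ⋀ S ≤ x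
    ⋀-greatest     : ∀ S y → (∀ x → S x → y ≤ x) → y ≤ ⋀ S

  ⊤L : Carrier
  ⊤L = ⋀ (λ _ → ⊥)

module _ {ℓ} (L : CompleteLattice ℓ) where
  open CompleteLattice L

  Pred : Set (suc ℓ)
  Pred = Carrier → Set ℓ

  Full : Pred
  Full _ = ⊤

  pair : Carrier → Carrier → Pred
  pair p q r = r ≡ p ⊎ r ≡ q

  IsGlbIn : Pred → Pred → Carrier → Set ℓ
  IsGlbIn P S p =
    P p × (∀ q → S q → p ≤ q) × (∀ r → P r → (∀ q → S q → r ≤ q) → r ≤ p)

  IsLubIn : Pred → Pred → Carrier → Set ℓ
  IsLubIn P S p =
    P p × (∀ q → S q → q ≤ p) × (∀ r → P r → (∀ q → S q → q ≤ r) → p ≤ r)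

  IsTopIn : Pred → Carrier → Set ℓ
  IsTopIn P p = P p × (∀ q → P q → q ≤ p)

  ιEmbedding : Pred → Set (suc ℓ)
  ιEmbedding L0 =
    (∀ (S : Pred) → (∀ q → S q → L0 q) → Σ[ p ∈ Carrier ] (IsGlbIn L0 S p × p ≡ ⋀ S))
    × IsTopIn L0 ⊤L

  OrderIsoFam : ∀ {f} {X : Set ℓ} → (Subset X → Set f) → Pred → Set (suc ℓ ⊔ f)
  OrderIsoFam {X = X} F L0 =
    Σ[ φ ∈ ((A : Subset X) → F A → Carrier) ]
      (∀ A a → L0 (φ A a))
      × (∀ A B (a : F A) (b : F B) → (B ⊆ A) ⇔ (φ A a ≤ φ B b))
      × (∀ q → L0 q → Σ[ A ∈ Subset X ] Σ[ a ∈ F A ] φ A a ≡ q)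

  cut : ∀ {X : Set ℓ} → (X → Carrier) → Carrier → Subset X
  cut μ p x = p ≤ μ x

  image : ∀ {X : Set ℓ} → (X → Carrier) → Pred
  image {X} μ q = Σ[ x ∈ X ] μ x ≡ q

  LevelSet : ∀ {X : Set ℓ} → Pred → (X → Carrier) → Carrier → Set (suc ℓ)
  LevelSet K μ p = Σ[ B ∈ Pred ] ((∀ q → B q → image μ q) × IsGlbIn K B p)

  CutFamilyIs : ∀ {f} {X : Set ℓ} → Pred → (X → Carrier) → (Subset X → Set f) → Set (suc ℓ ⊔ f)
  CutFamilyIs K μ F =
    (∀ p → K p → Σ[ A ∈ _ ] (F A × (A ≐ cut μ p)))
    × (∀ A → F A → Σ[ p ∈ Carrier ] (K p × (A ≐ cut μ p)))

  InH : ∀ {f} {X : Set ℓ} → Pred → Pred → (Subset X → Set f) → (X → Carrier) → Set (suc ℓ ⊔ f)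
  InH K L0 F μ =
    (∀ x → K (μ x))
    × (∀ p → LevelSet K μ p ⇔ L0 p)
    × CutFamilyIs K μ F

  -- η ∈ OI(L0): a lattice isomorphism of L0 onto itself.
  -- η is a map L0 → L0, given as a function on elements of L0 (with membership proof),
  -- independent of the membership proof.
  LatIso : (L0 : Pred) → ((p : Carrier) → L0 p → Carrier) → Set ℓ
  LatIso L0 η =
    (∀ p (a a' : L0 p) → η p a ≡ η p a')
    × (∀ p (a : L0 p) → L0 (η p a))
    × (∀ p q (a : L0 p) (b : L0 q) → η p a ≡ η q b → p ≡ q)
    × (∀ q → L0 q → Σ[ p ∈ Carrier ] Σ[ a ∈ L0 p ] η p a ≡ q)
    × (∀ p q m (a : L0 p) (b : L0 q) (c : L0 m) →
         IsGlbIn L0 (pair p q) m → IsGlbIn L0 (pair (η p a) (η q b)) (η m c))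
    × (∀ p q m (a : L0 p) (b : L0 q) (c : L0 m) →
         IsLubIn L0 (pair p q) m → IsLubIn L0 (pair (η p a) (η q b)) (η m c))

  -- { η ∘ g | η ∈ OI(L0) } ∋ μ   (and ι_(L0,L) ∘ η ∘ g is the same map into Carrier)
  InOrbit : ∀ {X : Set ℓ} → Pred → (X → Carrier) → (X → Carrier) → Set ℓ
  InOrbit {X} L0 g μ =
    Σ[ η ∈ ((p : Carrier) → L0 p → Carrier) ]
      (LatIso L0 η × (∀ x (a : L0 (g x)) → μ x ≡ η (g x) a))

-- A map μ ∈ H(L0,L0,F) is determined, up to relabelling its values, by its cut family:
-- every p ∈ L0 is an infimum of values of μ, hence the infimum of the values above p, so
-- p is recovered from the cut μ_p, and μ_q ⊆ μ_p iff p ≤ q. Given g and μ with the same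
-- cut family F, sending p to the level q with μ_q = g_p is therefore an order
-- automorphism η of L0, and μ = η ∘ g because μ_{μ x} and g_{g x} are both the least member
-- of F containing x. Conversely composing g with an order automorphism keeps the level set
-- and the cut family. Since L0 has binary meets, the order automorphisms of L0 are exactly
-- its lattice automorphisms. Finally H(L,L0,F) = H(L0,L0,F): L0 is closed under infima of L,
-- so every cut μ_p is also the cut at the point ⋀{μ x | p ≤ μ x} of L0.
module Submission where

open import Defs
open import Level using (Level)
open import Data.Product using (_×_; _,_; proj₁; proj₂; Σ-syntax)
open import Data.Sum using (inj₁; inj₂)
open import Data.Unit.Polymorphic using (tt)
open import Relation.Binary.PropositionalEquality using (_≡_; refl; sym; trans; subst)
open import Relation.Binary.Structures using (IsPartialOrder)

≐-sym : ∀ {ℓ} {X : Set ℓ} {A B : Subset X} → A ≐ B → B ≐ A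
≐-sym (A⊆B , B⊆A) = B⊆A , A⊆B

⊆-trans : ∀ {ℓ} {X : Set ℓ} {A B C : Subset X} → A ⊆ B → B ⊆ C → A ⊆ C
⊆-trans A⊆B B⊆C x a = B⊆C x (A⊆B x a)

≐-trans : ∀ {ℓ} {X : Set ℓ} {A B C : Subset X} → A ≐ B → B ≐ C → A ≐ C
≐-trans (A⊆B , B⊆A) (B⊆C , C⊆B) = (λ x a → B⊆C x (A⊆B x a)) , (λ x c → B⊆A x (C⊆B x c))

module _ {ℓ} (L : CompleteLattice ℓ) where
  open CompleteLattice L
  open IsPartialOrder isPartialOrder using (antisym; reflexive)
    renaming (refl to ≤-refl; trans to ≤-trans)

  glb-unique : ∀ {P S p q} → IsGlbIn L P S p → IsGlbIn L P S q → p ≡ q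
  glb-unique (p∈P , p-lower , p-greatest) (q∈P , q-lower , q-greatest) =
    antisym (q-greatest _ p∈P p-lower) (p-greatest _ q∈P q-lower)

  ⋀-isGlb : ∀ S → IsGlbIn L (Full L) S (⋀ S)
  ⋀-isGlb S = tt , ⋀-lower S , (λ r _ → ⋀-greatest S r)

  glb-restrict : ∀ {P S p} → IsGlbIn L (Full L) S p → P p → IsGlbIn L P S p
  glb-restrict (_ , lower , greatest) p∈P = p∈P , lower , (λ r _ → greatest r tt)

  glb-resp-≐ : ∀ {P S S′ p} → S ≐ S′ → IsGlbIn L P S p → IsGlbIn L P S′ p
  glb-resp-≐ (S⊆S′ , S′⊆S) (p∈P , lower , greatest) =
    p∈P , (λ q q∈S′ → lower q (S′⊆S q q∈S′))
    , (λ r r∈P bound → greatest r r∈P (λ q q∈S → bound q (S⊆S′ q q∈S)))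

  lub-resp-≐ : ∀ {P S S′ p} → S ≐ S′ → IsLubIn L P S p → IsLubIn L P S′ p
  lub-resp-≐ (S⊆S′ , S′⊆S) (p∈P , upper , least) =
    p∈P , (λ q q∈S′ → upper q (S′⊆S q q∈S′))
    , (λ r r∈P bound → least r r∈P (λ q q∈S → bound q (S⊆S′ q q∈S)))

  pair-⊆ : ∀ {P : Pred L} {p q} → P p → P q → pair L p q ⊆ P
  pair-⊆ p∈P q∈P _ (inj₁ refl) = p∈P
  pair-⊆ p∈P q∈P _ (inj₂ refl) = q∈P

  glb-pair-≤ : ∀ {P p q} → P p → p ≤ q → IsGlbIn L P (pair L p q) p
  glb-pair-≤ {P} {p} p∈P p≤q =
    p∈P , pair-⊆ {P = p ≤_} ≤-refl p≤q , (λ r _ bound → bound _ (inj₁ refl))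

  module _ {L0 : Pred L} (emb : ιEmbedding L L0) where

    glb-extend : ∀ {S p} → S ⊆ L0 → IsGlbIn L L0 S p → IsGlbIn L (Full L) S p
    glb-extend {S} S⊆L0 glb with proj₁ emb S S⊆L0
    ... | p′ , glb′ , p′≡⋀S =
      subst (IsGlbIn L (Full L) S) (sym (trans (glb-unique glb glb′) p′≡⋀S)) (⋀-isGlb S)

    glb-closed : ∀ {S p} → S ⊆ L0 → IsGlbIn L (Full L) S p → L0 p
    glb-closed {S} S⊆L0 glb with proj₁ emb S S⊆L0
    ... | p′ , glb′ , p′≡⋀S =
      subst L0 (trans p′≡⋀S (sym (glb-unique glb (⋀-isGlb S)))) (proj₁ glb′)

  cut-antitone : ∀ {X : Set ℓ} (ν : X → Carrier) {p q} → p ≤ q → cut L ν q ⊆ cut L ν p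
  cut-antitone ν p≤q x q≤νx = ≤-trans p≤q q≤νx

  image-⊆ : ∀ {X : Set ℓ} {ν : X → Carrier} {K : Pred L} → (∀ x → K (ν x)) → image L ν ⊆ K
  image-⊆ ν∈K q (x , refl) = ν∈K x

  module _ {X : Set ℓ} (ν : X → Carrier) where

    valuesAbove : Carrier → Pred L
    valuesAbove p q = Σ[ x ∈ X ] (p ≤ ν x × ν x ≡ q)

    value-levelSet : ∀ x → LevelSet L (Full L) ν (ν x)
    value-levelSet x =
      (ν x ≡_) , (λ q e → x , e) , tt , (λ q → reflexive) , (λ r _ bound → bound (ν x) refl)

    ⋀valuesAbove-levelSet : ∀ p → LevelSet L (Full L) ν (⋀ (valuesAbove p))
    ⋀valuesAbove-levelSet p = valuesAbove p , (λ q (x , _ , e) → x , e) , ⋀-isGlb (valuesAbove p)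

    ⋀valuesAbove-cut : ∀ p → cut L ν (⋀ (valuesAbove p)) ≐ cut L ν p
    ⋀valuesAbove-cut p =
      cut-antitone ν (⋀-greatest (valuesAbove p) p (λ q (x , p≤νx , e) → subst (p ≤_) e p≤νx))
      , (λ x p≤νx → ⋀-lower (valuesAbove p) (ν x) (x , p≤νx , refl))

    levelSet-greatest : ∀ {K p r} → LevelSet L K ν p → K r →
                        (∀ q → valuesAbove p q → r ≤ q) → r ≤ p
    levelSet-greatest {p = p} (B , B⊆image , _ , lower , greatest) r∈K bound =
      greatest _ r∈K (λ q q∈B → let (x , e) = B⊆image q q∈B in
        bound q (x , subst (p ≤_) (sym e) (lower q q∈B) , e))

    cut-⊆⇒≤ : ∀ {K p q} → LevelSet L K ν q → K p → cut L ν q ⊆ cut L ν p → p ≤ q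
    cut-⊆⇒≤ {p = p} q-level p∈K sub =
      levelSet-greatest q-level p∈K (λ r (x , q≤νx , e) → subst (p ≤_) e (sub x q≤νx))

    cut-injective : ∀ {K p q} → LevelSet L K ν p → LevelSet L K ν q → cut L ν p ≐ cut L ν q → p ≡ q
    cut-injective p-level@(_ , _ , p∈K , _) q-level@(_ , _ , q∈K , _) (p⊆q , q⊆p) =
      antisym (cut-⊆⇒≤ q-level p∈K q⊆p) (cut-⊆⇒≤ p-level q∈K p⊆q)

  module InH {f} {X : Set ℓ} {K L0 : Pred L} {F : Subset X → Set f} {ν : X → Carrier}
             (h : InH L K L0 F ν) where

    values : ∀ x → K (ν x)
    values = proj₁ h

    levelSet : ∀ p → L0 p → LevelSet L K ν p
    levelSet p = proj₂ (proj₁ (proj₂ h) p)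

    cut-∈-F : ∀ p → K p → Σ[ A ∈ Subset X ] (F A × (A ≐ cut L ν p))
    cut-∈-F = proj₁ (proj₂ (proj₂ h))

    ∈-F-is-cut : ∀ A → F A → Σ[ p ∈ Carrier ] (K p × (A ≐ cut L ν p))
    ∈-F-is-cut = proj₂ (proj₂ (proj₂ h))

    cut-value-least : ∀ {A} x → F A → A x → cut L ν (ν x) ⊆ A
    cut-value-least x A∈F x∈A with ∈-F-is-cut _ A∈F
    ... | p , _ , A⊆cut , cut⊆A = λ y νx≤νy → cut⊆A y (≤-trans (A⊆cut x x∈A) νx≤νy)

  open InH

  module _ {f} {X : Set ℓ} {F : Subset X → Set f} {K K′ L0 L0′ : Pred L} {g μ : X → Carrier}
           (hg : InH L K L0 F g) (hμ : InH L K′ L0′ F μ) where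

    matching-cut : ∀ {p} → K p → Σ[ p′ ∈ Carrier ] (K′ p′ × (cut L μ p′ ≐ cut L g p))
    matching-cut {p} p∈K with cut-∈-F hg p p∈K
    ... | A , A∈F , A≐g with ∈-F-is-cut hμ A A∈F
    ... | p′ , p′∈K′ , A≐μ = p′ , p′∈K′ , ≐-trans (≐-sym A≐μ) A≐g

    cut-value-⊆ : ∀ x → cut L g (g x) ⊆ cut L μ (μ x)
    cut-value-⊆ x with cut-∈-F hμ (μ x) (values hμ x)
    ... | A , A∈F , A⊆cut , cut⊆A = λ y k → A⊆cut y (cut-value-least hg x A∈F (cut⊆A x ≤-refl) y k)

  module _ (L0 : Pred L) where

    record IsOrderAutomorphism (η : (p : Carrier) → L0 p → Carrier) : Set ℓ where
      field
        closed     : ∀ p a → L0 (η p a)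
        surjective : ∀ q → L0 q → Σ[ p ∈ Carrier ] Σ[ a ∈ L0 p ] η p a ≡ q
        monotone   : ∀ p q a b → p ≤ q → η p a ≤ η q b
        reflects   : ∀ p q a b → η p a ≤ η q b → p ≤ q

      proof-irrelevant : ∀ p (a a′ : L0 p) → η p a ≡ η p a′
      proof-irrelevant p a a′ = antisym (monotone p p a a′ ≤-refl) (monotone p p a′ a ≤-refl)

      cong : ∀ {p q} → p ≡ q → (a : L0 p) (b : L0 q) → η p a ≡ η q b
      cong refl = proof-irrelevant _

      injective : ∀ p q a b → η p a ≡ η q b → p ≡ q
      injective p q a b e = antisym (reflects p q a b (reflexive e)) (reflects q p b a (reflexive (sym e)))

      directImage : Pred L → Pred L
      directImage S q = Σ[ q′ ∈ Carrier ] Σ[ _ ∈ S q′ ] Σ[ a ∈ L0 q′ ] η q′ a ≡ q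

      directImage-pair : ∀ {p q} (a : L0 p) (b : L0 q) → pair L (η p a) (η q b) ≐ directImage (pair L p q)
      directImage-pair {p} {q} a b = to , from
        where
        to : pair L (η p a) (η q b) ⊆ directImage (pair L p q)
        to _ (inj₁ refl) = p , inj₁ refl , a , refl
        to _ (inj₂ refl) = q , inj₂ refl , b , refl
        from : directImage (pair L p q) ⊆ pair L (η p a) (η q b)
        from _ (_ , inj₁ refl , a′ , refl) = inj₁ (proof-irrelevant p a′ a)
        from _ (_ , inj₂ refl , b′ , refl) = inj₂ (proof-irrelevant q b′ b)

      preserves-glb : ∀ {S p} (c : L0 p) → S ⊆ L0 → IsGlbIn L L0 S p → IsGlbIn L L0 (directImage S) (η p c)
      preserves-glb {S} {p} c S⊆L0 (_ , lower , greatest) = closed p c , lower′ , greatest′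
        where
        lower′ : ∀ q → directImage S q → η p c ≤ q
        lower′ _ (q′ , q′∈S , a , refl) = monotone p q′ c a (lower q′ q′∈S)
        greatest′ : ∀ r → L0 r → (∀ q → directImage S q → r ≤ q) → r ≤ η p c
        greatest′ r r∈L0 bound with surjective r r∈L0
        ... | r′ , a , refl = monotone r′ p a c (greatest r′ a (λ q q∈S →
          reflects r′ q a (S⊆L0 q q∈S) (bound _ (q , q∈S , S⊆L0 q q∈S , refl))))

      preserves-lub : ∀ {S p} (c : L0 p) → S ⊆ L0 → IsLubIn L L0 S p → IsLubIn L L0 (directImage S) (η p c)
      preserves-lub {S} {p} c S⊆L0 (_ , upper , least) = closed p c , upper′ , least′
        where
        upper′ : ∀ q → directImage S q → q ≤ η p c
        upper′ _ (q′ , q′∈S , a , refl) = monotone q′ p a c (upper q′ q′∈S)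
        least′ : ∀ r → L0 r → (∀ q → directImage S q → q ≤ r) → η p c ≤ r
        least′ r r∈L0 bound with surjective r r∈L0
        ... | r′ , a , refl = monotone p r′ c a (least r′ a (λ q q∈S →
          reflects q r′ (S⊆L0 q q∈S) a (bound _ (q , q∈S , S⊆L0 q q∈S , refl))))

    orderAutomorphism⇒latIso : ∀ {η} → IsOrderAutomorphism η → LatIso L L0 η
    orderAutomorphism⇒latIso iso =
      proof-irrelevant , closed , injective , surjective
      , (λ p q m a b c glb → glb-resp-≐ (≐-sym (directImage-pair a b)) (preserves-glb c (pair-⊆ a b) glb))
      , (λ p q m a b c lub → lub-resp-≐ (≐-sym (directImage-pair a b)) (preserves-lub c (pair-⊆ a b) lub))
      where open IsOrderAutomorphism iso

    -- Reflecting the order is where binary meets in L0 are needed.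
    latIso⇒orderAutomorphism : ∀ {η} → ιEmbedding L L0 → LatIso L L0 η → IsOrderAutomorphism η
    latIso⇒orderAutomorphism {η} emb (_ , closed , injective , surjective , meet , _) =
      record { closed = closed ; surjective = surjective ; monotone = monotone ; reflects = reflects }
      where
      monotone : ∀ p q a b → p ≤ q → η p a ≤ η q b
      monotone p q a b p≤q = proj₁ (proj₂ (meet p q p a b a (glb-pair-≤ a p≤q))) _ (inj₂ refl)

      reflects : ∀ p q a b → η p a ≤ η q b → p ≤ q
      reflects p q a b ηp≤ηq with proj₁ emb (pair L p q) (pair-⊆ a b)
      ... | m , glb@(c , m-lower , _) , _ = subst (_≤ q) m≡p (m-lower q (inj₂ refl))
        where
        m≡p : m ≡ p
        m≡p = injective m p c a (glb-unique (meet p q m a b c glb) (glb-pair-≤ (closed p a) ηp≤ηq))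

  module _ {f} {X : Set ℓ} {F : Subset X → Set f} {L0 : Pred L} {g μ : X → Carrier}
           (hg : InH L L0 L0 F g) (hμ : InH L L0 L0 F μ) where

    cut-transport : (p : Carrier) → L0 p → Carrier
    cut-transport p a = proj₁ (matching-cut hg hμ a)

    cut-transport-∈ : ∀ p a → L0 (cut-transport p a)
    cut-transport-∈ p a = proj₁ (proj₂ (matching-cut hg hμ a))

    cut-transport-cut : ∀ p a → cut L μ (cut-transport p a) ≐ cut L g p
    cut-transport-cut p a = proj₂ (proj₂ (matching-cut hg hμ a))

    cut-transport-level : ∀ p a → LevelSet L L0 μ (cut-transport p a)
    cut-transport-level p a = levelSet hμ _ (cut-transport-∈ p a)

    cut-transport-isOrderAutomorphism : IsOrderAutomorphism L0 cut-transport
    cut-transport-isOrderAutomorphism = record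
      { closed     = cut-transport-∈
      ; surjective = surjective
      ; monotone   = λ p q a b p≤q → cut-⊆⇒≤ μ (cut-transport-level q b) (cut-transport-∈ p a)
          (⊆-trans (proj₁ (cut-transport-cut q b)) (⊆-trans (cut-antitone g p≤q) (proj₂ (cut-transport-cut p a))))
      ; reflects   = λ p q a b ηp≤ηq → cut-⊆⇒≤ g (levelSet hg q b) a
          (⊆-trans (proj₂ (cut-transport-cut q b)) (⊆-trans (cut-antitone μ ηp≤ηq) (proj₁ (cut-transport-cut p a))))
      }
      where
      surjective : ∀ q → L0 q → Σ[ p ∈ Carrier ] Σ[ a ∈ L0 p ] cut-transport p a ≡ q
      surjective q b with matching-cut hμ hg b
      ... | p , a , g≐μ = p , a , cut-injective μ (cut-transport-level p a) (levelSet hμ q b)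
                                    (≐-trans (cut-transport-cut p a) g≐μ)

    cut-transport-value : ∀ x (a : L0 (g x)) → μ x ≡ cut-transport (g x) a
    cut-transport-value x a =
      cut-injective μ (levelSet hμ _ (values hμ x)) (cut-transport-level (g x) a)
        (≐-trans (cut-value-⊆ hμ hg x , cut-value-⊆ hg hμ x) (≐-sym (cut-transport-cut (g x) a)))

    InH⇒InOrbit : InOrbit L L0 g μ
    InH⇒InOrbit = cut-transport
                , orderAutomorphism⇒latIso L0 cut-transport-isOrderAutomorphism
                , cut-transport-value

  module _ {f} {X : Set ℓ} {F : Subset X → Set f} {L0 : Pred L} {g μ : X → Carrier}
           {η : (p : Carrier) → L0 p → Carrier} (iso : IsOrderAutomorphism L0 η)
           (hg : InH L L0 L0 F g) (μ≡η∘g : ∀ x (a : L0 (g x)) → μ x ≡ η (g x) a) where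
    open IsOrderAutomorphism iso

    composite-cut : ∀ p a → cut L μ (η p a) ≐ cut L g p
    composite-cut p a =
      (λ x ηp≤μx → reflects p (g x) a gx∈L0 (subst (η p a ≤_) (μ≡η∘g x gx∈L0) ηp≤μx))
      , (λ x p≤gx → subst (η p a ≤_) (sym (μ≡η∘g x gx∈L0)) (monotone p (g x) a gx∈L0 p≤gx))
      where
      gx∈L0 : ∀ {x} → L0 (g x)
      gx∈L0 {x} = values hg x

    composite-InH : InH L L0 L0 F μ
    composite-InH =
      values′ , (λ p → (λ (_ , _ , p∈L0 , _) → p∈L0) , levelSet′ p) , cut-∈-F′ , ∈-F-is-cut′
      where
      values′ : ∀ x → L0 (μ x)
      values′ x = subst L0 (sym (μ≡η∘g x (values hg x))) (closed _ _)

      levelSet′ : ∀ p → L0 p → LevelSet L L0 μ p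
      levelSet′ p p∈L0 with surjective p p∈L0
      ... | p′ , a , refl with levelSet hg p′ a
      ... | B , B⊆image , glb =
        directImage B , image′ , preserves-glb a (⊆-trans B⊆image (image-⊆ (values hg))) glb
        where
        image′ : directImage B ⊆ image L μ
        image′ _ (q , q∈B , b , refl) = let (x , gx≡q) = B⊆image q q∈B in
          x , trans (μ≡η∘g x (values hg x)) (cong gx≡q (values hg x) b)

      cut-∈-F′ : ∀ p → L0 p → Σ[ A ∈ Subset X ] (F A × (A ≐ cut L μ p))
      cut-∈-F′ p p∈L0 with surjective p p∈L0
      ... | p′ , a , refl with cut-∈-F hg p′ a
      ... | A , A∈F , A≐ = A , A∈F , ≐-trans A≐ (≐-sym (composite-cut p′ a))

      ∈-F-is-cut′ : ∀ A → F A → Σ[ p ∈ Carrier ] (L0 p × (A ≐ cut L μ p))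
      ∈-F-is-cut′ A A∈F with ∈-F-is-cut hg A A∈F
      ... | p′ , a , A≐ = η p′ a , closed p′ a , ≐-trans A≐ (≐-sym (composite-cut p′ a))

  module _ {f} {X : Set ℓ} {F : Subset X → Set f} {L0 : Pred L} {μ : X → Carrier}
           (emb : ιEmbedding L L0) where

    full-levelSet⇒∈ : (∀ x → L0 (μ x)) → ∀ {p} → LevelSet L (Full L) μ p → L0 p
    full-levelSet⇒∈ μ∈L0 (B , B⊆image , glb) = glb-closed emb (⊆-trans B⊆image (image-⊆ μ∈L0)) glb

    cut-at-L0 : (∀ x → L0 (μ x)) → ∀ p → Σ[ p′ ∈ Carrier ] (L0 p′ × (cut L μ p′ ≐ cut L μ p))
    cut-at-L0 μ∈L0 p = ⋀ (valuesAbove μ p)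
                     , full-levelSet⇒∈ μ∈L0 (⋀valuesAbove-levelSet μ p)
                     , ⋀valuesAbove-cut μ p

    InH-Full⇒InH-L0 : InH L (Full L) L0 F μ → InH L L0 L0 F μ
    InH-Full⇒InH-L0 h = μ∈L0 , (λ p → (λ (_ , _ , p∈L0 , _) → p∈L0) , levelSet′ p)
                      , (λ p _ → cut-∈-F h p tt) , ∈-F-is-cut′
      where
      μ∈L0 : ∀ x → L0 (μ x)
      μ∈L0 x = proj₁ (proj₁ (proj₂ h) (μ x)) (value-levelSet μ x)

      levelSet′ : ∀ p → L0 p → LevelSet L L0 μ p
      levelSet′ p p∈L0 = let (B , B⊆image , glb) = levelSet h p p∈L0 in B , B⊆image , glb-restrict glb p∈L0

      ∈-F-is-cut′ : ∀ A → F A → Σ[ p ∈ Carrier ] (L0 p × (A ≐ cut L μ p))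
      ∈-F-is-cut′ A A∈F with ∈-F-is-cut h A A∈F
      ... | p , _ , A≐ with cut-at-L0 μ∈L0 p
      ... | p′ , p′∈L0 , p′≐p = p′ , p′∈L0 , ≐-trans A≐ (≐-sym p′≐p)

    InH-L0⇒InH-Full : InH L L0 L0 F μ → InH L (Full L) L0 F μ
    InH-L0⇒InH-Full h = (λ _ → tt) , (λ p → full-levelSet⇒∈ (values h) , levelSet′ p)
                      , cut-∈-F′ , (λ A A∈F → let (p , _ , A≐) = ∈-F-is-cut h A A∈F in p , tt , A≐)
      where
      levelSet′ : ∀ p → L0 p → LevelSet L (Full L) μ p
      levelSet′ p p∈L0 = let (B , B⊆image , glb) = levelSet h p p∈L0 in
        B , B⊆image , glb-extend emb (⊆-trans B⊆image (image-⊆ (values h))) glb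

      cut-∈-F′ : ∀ p → Full L p → Σ[ A ∈ Subset X ] (F A × (A ≐ cut L μ p))
      cut-∈-F′ p _ with cut-at-L0 (values h) p
      ... | p′ , p′∈L0 , p′≐p with cut-∈-F h p′ p′∈L0
      ... | A , A∈F , A≐ = A , A∈F , ≐-trans A≐ p′≐p

corollary8 : ∀ {ℓ f : Level}
    (X : Set ℓ) (x₀ : X)
    (F : Subset X → Set f) → ClosedUnderIntersections F → F (Whole X)
    → (L : CompleteLattice ℓ) (L0 : Pred L)
    → OrderIsoFam L F L0
    → ιEmbedding L L0
    → (g : X → CompleteLattice.Carrier L) → InH L L0 L0 F g
    → ((μ : X → CompleteLattice.Carrier L) → InH L L0 L0 F μ ⇔ InOrbit L L0 g μ)
    × ((μ : X → CompleteLattice.Carrier L) → InH L (Full L) L0 F μ ⇔ InOrbit L L0 g μ)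
corollary8 X _ F _ _ L L0 _ emb g hg = H-L0-orbit , H-Full-orbit
  where
  H-L0-orbit : ∀ μ → InH L L0 L0 F μ ⇔ InOrbit L L0 g μ
  H-L0-orbit μ = InH⇒InOrbit L hg
               , (λ (_ , latIso , μ≡η∘g) →
                    composite-InH L (latIso⇒orderAutomorphism L L0 emb latIso) hg μ≡η∘g)

  H-Full-orbit : ∀ μ → InH L (Full L) L0 F μ ⇔ InOrbit L L0 g μ
  H-Full-orbit μ = (λ h → proj₁ (H-L0-orbit μ) (InH-Full⇒InH-L0 L emb h))
                 , (λ o → InH-L0⇒InH-Full L emb (proj₂ (H-L0-orbit μ) o))
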